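{- A hedgegraph $G=(V,E)$ is $1$-partition connected if and only if there is a subset $F\subseteq E$ such that the sub-hedgegraph $(V,F)$ has a trimming that is a spanning tree on $V$.
   Context: A hedgegraph $G=(V,E)$ consists of a finite vertex set $V$ and a finite set $E$ of hedges; each hedge is a set of hyperedges (subsets of $V$), the hyperedges within one hedge are pairwise vertex-disjoint, and no hyperedge belongs to two hedges. For a partition $\mathcal{P}$ of $V$ into nonempty parts, $\delta(\mathcal{P})$ is the set of hedges containing a hyperedge that intersects at least two parts of $\mathcal{P}$. $G$ is $1$-partition connected if $|\delta(\mathcal{P})|\ge |\mathcal{P}|-1$ for every partition $\mathcal{P}$ of $V$. A trimming of a hedge $e$ chooses one hyperedge $h\in e$ and two distinct vertices $u,v\in h$ and replaces $e$ by the single edge $\{u,v\}$; a trimming of a hedgegraph $(V,F)$ trims every hedge of $F$ (no hedge is deleted), yielding a multigraph on $V$ with exactly $|F|$ edges. -}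

module Defs where

open import Data.Nat using (ℕ; zero; suc; _∸_)
open import Data.Fin using (Fin; zero; suc; inject₁; fromℕ)
open import Data.Fin.Subset using (Subset; _∈_)
open import Data.List using (List; length; lookup)
import Data.List.Membership.Propositional as LM
open import Data.Product using (Σ; ∃; ∃-syntax; _×_; _,_; proj₁; proj₂)
open import Data.Sum using (_⊎_)
open import Data.Empty using (⊥)
open import Relation.Nullary using (¬_)
open import Relation.Binary.PropositionalEquality using (_≡_; _≢_)
open import Relation.Binary.Construct.Closure.ReflexiveTransitive using (Star)
open import Function.Definitions using (Injective; Surjective)

-- Hedgegraphs.
-- Vertex set V = Fin n.  A hyperedge is a subset of V (Subset n).
-- The hedges are indexed by Fin m; hedge e is a finite list of hyperedges.

record Hedgegraph : Set where
  field
    n     : ℕ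
    m     : ℕ
    hedge : Fin m → List (Subset n)

open Hedgegraph public

Disjoint : ∀ {n} → Subset n → Subset n → Set
Disjoint h h' = ∀ v → v ∈ h → v ∈ h' → ⊥

-- Well-formedness conditions from the definition of a hedgegraph:
--  * hyperedges within one hedge are pairwise vertex-disjoint;
--  * no hyperedge belongs to two (distinct) hedges.
record WellFormed (G : Hedgegraph) : Set where
  field
    within-disjoint : ∀ (e : Fin (m G)) (i j : Fin (length (hedge G e))) →
                      i ≢ j → Disjoint (lookup (hedge G e) i) (lookup (hedge G e) j)
    no-shared       : ∀ (e e' : Fin (m G)) (h : Subset (n G)) →
                      h LM.∈ hedge G e → h LM.∈ hedge G e' → e ≡ e'

-- Partitions of V into k nonempty parts, given as a surjective labelling
-- p : V → Fin k (part i is p⁻¹(i), nonempty by surjectivity); |P| = k.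

record Partition (n k : ℕ) : Set where
  field
    label : Fin n → Fin k
    surj  : Surjective _≡_ _≡_ label

open Partition public

Crosses : (G : Hedgegraph) {k : ℕ} → Partition (n G) k → Fin (m G) → Set
Crosses G P e = ∃[ h ] (h LM.∈ hedge G e ×
                 ∃[ u ] ∃[ v ] (u ∈ h × v ∈ h × label P u ≢ label P v))

-- |δ(P)| ≥ k - 1 : there are k-1 distinct hedges in δ(P).
-- (For k = 0 the bound k - 1 = -1 is vacuous, matching k ∸ 1 = 0.)
OnePartitionConnected : Hedgegraph → Set
OnePartitionConnected G =
  ∀ (k : ℕ) (P : Partition (n G) k) →
  Σ (Fin (k ∸ 1) → Fin (m G)) λ f → Injective _≡_ _≡_ f × (∀ i → Crosses G P (f i))

-- Multigraphs on Fin n with ℓ edges, edge i having endpoints ends i.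

Adjacent : ∀ {n ℓ} → (Fin ℓ → Fin n × Fin n) → Fin n → Fin n → Set
Adjacent ends u v = ∃[ i ] (ends i ≡ (u , v) ⊎ ends i ≡ (v , u))

Connected : ∀ {n ℓ} → (Fin ℓ → Fin n × Fin n) → Set
Connected ends = ∀ u v → Star (Adjacent ends) u v

Joins : ∀ {n} → Fin n × Fin n → Fin n → Fin n → Set
Joins e a b = e ≡ (a , b) ⊎ e ≡ (b , a)

-- A cycle of length k ≥ 1: closed walk w 0, w 1, ..., w k = w 0 using
-- k distinct edges g 0..g (k-1), edge g i joining w i and w (i+1),
-- with w 0, ..., w (k-1) pairwise distinct.
-- (k = 1: a loop; k = 2: a pair of parallel edges.)
Cycle : ∀ {n ℓ} → (Fin ℓ → Fin n × Fin n) → Set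
Cycle {n} {ℓ} ends =
  ∃[ k ] Σ (Fin (suc (suc k)) → Fin n) λ w → Σ (Fin (suc k) → Fin ℓ) λ g →
    Injective _≡_ _≡_ g ×
    Injective _≡_ _≡_ (λ i → w (inject₁ i)) ×
    w zero ≡ w (fromℕ (suc k)) ×
    (∀ i → Joins (ends (g i)) (w (inject₁ i)) (w (suc i)))

Acyclic : ∀ {n ℓ} → (Fin ℓ → Fin n × Fin n) → Set
Acyclic ends = ¬ Cycle ends

IsSpanningTree : ∀ {n ℓ} → (Fin ℓ → Fin n × Fin n) → Set
IsSpanningTree ends = Connected ends × Acyclic ends

-- A subset F ⊆ E with |F| = ℓ is given by an injective enumeration
-- f : Fin ℓ → Fin m.

IsTrimming : (G : Hedgegraph) {ℓ : ℕ} → (Fin ℓ → Fin (m G)) →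
             (Fin ℓ → Fin (n G) × Fin (n G)) → Set
IsTrimming G f ends =
  ∀ i → ∃[ h ] (h LM.∈ hedge G (f i) ×
         proj₁ (ends i) ∈ h × proj₂ (ends i) ∈ h × proj₁ (ends i) ≢ proj₂ (ends i))

HasSpanningTreeTrimming : Hedgegraph → Set
HasSpanningTreeTrimming G =
  ∃[ ℓ ] Σ (Fin ℓ → Fin (m G)) λ f → Injective _≡_ _≡_ f ×
    Σ (Fin ℓ → Fin (n G) × Fin (n G)) λ ends →
      IsTrimming G f ends × IsSpanningTree ends

-- Both directions count connected components of graphs on V.
-- (⇐) Relabelling the vertices of the spanning tree by the parts of a partition P into k parts gives a
-- connected multigraph on k vertices, so at least k − 1 of its edges are not loops; the hedges trimmed
-- to those edges cross P, and they are distinct.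
-- (⇒) Offer every hedge all edges it can be trimmed to as candidates.  For the partition of V into the
-- components spanned by the candidates of a set J of hedges, 1-partition connectivity says exactly that
-- these components number at most |E ∖ J| + 1: Rado's condition.  As in Welsh's proof of Rado's
-- theorem, submodularity of the component count lets us delete candidates, keeping Rado's condition,
-- until every hedge has at most one.  Rado's condition for J = E then says the remaining candidates
-- connect V, and a greedy spanning forest of them is a spanning tree whose edges come from distinct
-- hedges.

module Submission where

open import Defs
open import Level using (0ℓ)
open import Data.Nat as ℕ using (ℕ; zero; suc; _+_; _∸_; _≤_; _<_; _<?_; z≤n; s≤s)
import Data.Nat.Properties as ℕ
open import Data.Nat.Induction using (<-wellFounded)
open import Algebra.Properties.CommutativeMonoid.Sum ℕ.+-0-commutativeMonoid using (sum; sum-remove; sum-cong-≗)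
open import Algebra.Properties.CommutativeSemigroup ℕ.+-commutativeSemigroup using (interchange)
open import Data.Fin as Fin using (Fin; zero; suc; inject≤; inject₁; fromℕ; punchIn; punchOut; _≟_)
import Data.Fin.Properties as Fin
open import Data.Fin.Subset
  using (Subset; inside; outside; ⊤; _∪_; _∩_; ∁; ⁅_⁆) renaming (_∈_ to _∈ₛ_; _∉_ to _∉ₛ_)
open import Data.Fin.Subset.Properties
  using (_∈?_; ∈⊤; anySubset?; x∈p∪q⁺; x∈p∪q⁻; x∈p∩q⁺; x∈p∩q⁻; x∉p⇒x∈∁p; x∈∁p⇒x∉p; x∈⁅x⁆; x≢y⇒x∉⁅y⁆)
open import Data.Vec using ([]; _∷_; here; there)
open import Data.Vec.Functional using (updateAt)
open import Data.Vec.Functional.Properties using (updateAt-updates; updateAt-minimal)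
open import Data.List
  using (List; []; _∷_; _++_; map; filter; length; lookup; tabulate; cartesianProduct; allFin)
open import Data.List.Properties using (length-tabulate; map-tabulate; tabulate-lookup; filter-notAll)
open import Data.List.Membership.Propositional using (_∈_; find; lose)
open import Data.List.Membership.Propositional.Properties
  using ( ∈-++⁺ˡ; ∈-++⁺ʳ; ∈-++⁻; ∈-filter⁺; ∈-filter⁻; ∈-cartesianProduct⁺; ∈-allFin
        ; ∈-tabulate⁺; ∈-tabulate⁻; ∈-map⁺; ∈-map⁻; ∈-lookup)
open import Data.List.Relation.Binary.Subset.Propositional using (_⊆_)
open import Data.List.Relation.Binary.Subset.Propositional.Properties using (xs⊆xs++ys; ++⁺ʳ)
open import Data.List.Relation.Unary.Any using (here; there; any?)
import Data.List.Relation.Unary.All as All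
open import Data.List.Relation.Unary.All.Properties using (¬All⇒Any¬)
open import Data.List.Relation.Unary.AllPairs using (AllPairs; []; _∷_)
open import Data.Product as Product using (Σ; ∃; ∃₂; ∃-syntax; _×_; _,_; proj₁; proj₂)
open import Data.Product.Properties using (≡-dec)
open import Data.Sum as Sum using (_⊎_; inj₁; inj₂; [_,_]′)
open import Data.Empty using (⊥; ⊥-elim)
open import Function using (_∘_; id; _⇔_; mk⇔)
open import Function.Definitions using (Injective)
open import Induction.WellFounded using (Acc; acc)
open import Relation.Binary using (DecidableEquality; tri<; tri≈; tri>)
open import Relation.Binary.Construct.Closure.ReflexiveTransitive as Star using (Star; ε; _◅_; _◅◅_)
open import Relation.Binary.PropositionalEquality
  using (_≡_; _≢_; refl; sym; trans; cong; cong₂; subst; subst₂; module ≡-Reasoning)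
open import Relation.Nullary using (¬_; Dec; yes; no; contradiction; ¬?)
open import Relation.Nullary.Decidable using (_×-dec_; _⊎-dec_; _→-dec_; map′)
open import Relation.Unary using (Pred; Decidable)

-- Counting decidable predicates on Fin n

count : ∀ {n} {P : Pred (Fin n) 0ℓ} → Decidable P → ℕ
count {zero} P? = 0
count {suc n} P? with P? zero
... | yes _ = suc (count (P? ∘ suc))
... | no _ = count (P? ∘ suc)

count-cong : ∀ {n} {P Q : Pred (Fin n) 0ℓ} (P? : Decidable P) (Q? : Decidable Q) →
             (∀ {i} → P i → Q i) → (∀ {i} → Q i → P i) → count P? ≡ count Q?
count-cong {zero} P? Q? P⇒Q Q⇒P = refl
count-cong {suc n} P? Q? P⇒Q Q⇒P with P? zero | Q? zero
... | yes _ | yes _ = cong suc (count-cong (P? ∘ suc) (Q? ∘ suc) P⇒Q Q⇒P)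
... | yes p | no ¬q = contradiction (P⇒Q p) ¬q
... | no ¬p | yes q = contradiction (Q⇒P q) ¬p
... | no _ | no _ = count-cong (P? ∘ suc) (Q? ∘ suc) P⇒Q Q⇒P

count-all : ∀ {n} {P : Pred (Fin n) 0ℓ} (P? : Decidable P) → (∀ i → P i) → count P? ≡ n
count-all {zero} P? all = refl
count-all {suc n} P? all with P? zero
... | yes _ = cong suc (count-all (P? ∘ suc) (all ∘ suc))
... | no ¬p = contradiction (all zero) ¬p

count-+-count-¬ : ∀ {n} {P : Pred (Fin n) 0ℓ} (P? : Decidable P) → count P? + count (¬? ∘ P?) ≡ n
count-+-count-¬ {zero} P? = refl
count-+-count-¬ {suc n} P? with P? zero
... | yes _ = cong suc (count-+-count-¬ (P? ∘ suc))
... | no _ = trans (ℕ.+-suc _ _) (cong suc (count-+-count-¬ (P? ∘ suc)))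

count-⊎-+-count-× : ∀ {n} {P Q : Pred (Fin n) 0ℓ} (P? : Decidable P) (Q? : Decidable Q) →
                    count (λ i → P? i ⊎-dec Q? i) + count (λ i → P? i ×-dec Q? i) ≡ count P? + count Q?
count-⊎-+-count-× {zero} P? Q? = refl
count-⊎-+-count-× {suc n} P? Q? with P? zero | Q? zero
... | yes _ | yes _ = cong suc (trans (ℕ.+-suc _ _) (trans (cong suc ih) (sym (ℕ.+-suc _ _))))
  where ih = count-⊎-+-count-× (P? ∘ suc) (Q? ∘ suc)
... | yes _ | no _ = cong suc (count-⊎-+-count-× (P? ∘ suc) (Q? ∘ suc))
... | no _ | yes _ = trans (cong suc (count-⊎-+-count-× (P? ∘ suc) (Q? ∘ suc))) (sym (ℕ.+-suc _ _))
... | no _ | no _ = count-⊎-+-count-× (P? ∘ suc) (Q? ∘ suc)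

private
  count-≢-suc : ∀ {n} {P : Pred (Fin n) 0ℓ} (P? : Decidable P) (z : Fin n) →
                count (λ i → P? i ×-dec ¬? (i ≟ z)) ≡ count (λ i → P? i ×-dec ¬? (suc i ≟ suc z))
  count-≢-suc P? z =
    count-cong (λ i → P? i ×-dec ¬? (i ≟ z)) (λ i → P? i ×-dec ¬? (suc i ≟ suc z))
               (λ (p , i≢z) → p , i≢z ∘ Fin.suc-injective) (λ (p , i≢z) → p , i≢z ∘ cong suc)

count-remove : ∀ {n} {P : Pred (Fin n) 0ℓ} (P? : Decidable P) {z : Fin n} → P z →
               count P? ≡ suc (count (λ i → P? i ×-dec ¬? (i ≟ z)))
count-remove {suc n} P? {zero} pz with P? zero
... | no ¬pz = contradiction pz ¬pz
... | yes _ = cong suc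
  (count-cong (P? ∘ suc) (λ i → P? (suc i) ×-dec ¬? (suc i ≟ zero)) (λ p → p , Fin.0≢1+n ∘ sym) proj₁)
count-remove {suc n} P? {suc z} pz with P? zero
... | yes _ = cong suc (trans (count-remove (P? ∘ suc) pz) (cong suc (count-≢-suc (P? ∘ suc) z)))
... | no _ = trans (count-remove (P? ∘ suc) pz) (cong suc (count-≢-suc (P? ∘ suc) z))

record Enumeration {n} (P : Pred (Fin n) 0ℓ) (k : ℕ) : Set where
  field
    at            : Fin k → Fin n
    at-injective  : Injective _≡_ _≡_ at
    at-satisfies  : ∀ k → P (at k)
    at-surjective : ∀ {i} → P i → ∃ λ k → at k ≡ i

enumerate : ∀ {n} {P : Pred (Fin n) 0ℓ} (P? : Decidable P) → Enumeration P (count P?)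
enumerate {zero} P? = record
  { at = λ () ; at-injective = λ { {()} } ; at-satisfies = λ () ; at-surjective = λ { {()} } }
enumerate {suc n} {P} P? with P? zero | enumerate (P? ∘ suc)
... | yes p₀ | E = record
  { at = at′ ; at-injective = injective ; at-satisfies = satisfies ; at-surjective = surjective }
  where
    open Enumeration E
    at′ : Fin (suc (count (P? ∘ suc))) → Fin (suc n)
    at′ zero = zero
    at′ (suc k) = suc (at k)
    injective : Injective _≡_ _≡_ at′
    injective {zero} {zero} _ = refl
    injective {suc k} {suc l} eq = cong suc (at-injective (Fin.suc-injective eq))
    satisfies : ∀ k → P (at′ k)
    satisfies zero = p₀
    satisfies (suc k) = at-satisfies k
    surjective : ∀ {i} → P i → ∃ λ k → at′ k ≡ i
    surjective {zero} _ = zero , refl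
    surjective {suc i} p = let k , eq = at-surjective p in suc k , cong suc eq
... | no ¬p₀ | E = record
  { at = suc ∘ at ; at-injective = at-injective ∘ Fin.suc-injective ; at-satisfies = at-satisfies
  ; at-surjective = surjective }
  where
    open Enumeration E
    surjective : ∀ {i} → P i → ∃ λ k → suc (at k) ≡ i
    surjective {zero} p = contradiction p ¬p₀
    surjective {suc i} p = let k , eq = at-surjective p in k , cong suc eq

module _ {n} {P : Pred (Fin n) 0ℓ} (P? : Decidable P) where

  open Enumeration (enumerate P?)

  injection⇒≤count : ∀ {a} (f : Fin a → Fin n) → Injective _≡_ _≡_ f → (∀ k → P (f k)) → a ≤ count P?
  injection⇒≤count {a} f f-injective f-satisfies = Fin.injective⇒≤ {f = position} position-injective
    where
      position : Fin a → Fin (count P?)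
      position k = proj₁ (at-surjective (f-satisfies k))
      position-injective : Injective _≡_ _≡_ position
      position-injective {k} {l} eq = f-injective (begin
        f k                 ≡⟨ sym (proj₂ (at-surjective (f-satisfies k))) ⟩
        at (position k)     ≡⟨ cong at eq ⟩
        at (position l)     ≡⟨ proj₂ (at-surjective (f-satisfies l)) ⟩
        f l                 ∎)
        where open ≡-Reasoning

  ≤count⇒injection : ∀ {a} → a ≤ count P? →
                     Σ (Fin a → Fin n) λ f → Injective _≡_ _≡_ f × (∀ k → P (f k))
  ≤count⇒injection a≤ =
    at ∘ (λ k → inject≤ k a≤) ,
    (λ eq → Fin.inject≤-injective a≤ a≤ _ _ (at-injective eq)) ,
    λ k → at-satisfies _

  count≤1 : (∀ {u v} → P u → P v → u ≡ v) → count P? ≤ 1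
  count≤1 unique = ℕ.≮⇒≥ λ 2≤count →
    let f , f-injective , f-satisfies = ≤count⇒injection 2≤count
    in Fin.0≢1+n (f-injective (unique (f-satisfies zero) (f-satisfies (suc zero))))

least : ∀ {n} {P : Pred (Fin n) 0ℓ} → Decidable P → ∀ {i} → P i → ∃ λ m → P m × (∀ {j} → P j → m Fin.≤ j)
least {suc n} P? {i} pᵢ with P? zero | i
... | yes p₀ | _ = zero , p₀ , λ _ → z≤n
... | no ¬p₀ | zero = contradiction pᵢ ¬p₀
... | no ¬p₀ | suc i′ =
  let m , pₘ , m-least = least (P? ∘ suc) pᵢ
  in suc m , pₘ , λ { {zero} p₀ → contradiction p₀ ¬p₀ ; {suc j} pⱼ → s≤s (m-least pⱼ) }

∀⊎∃ : ∀ {k} {P Q : Pred (Fin k) 0ℓ} → (∀ i → P i ⊎ Q i) → (∀ i → P i) ⊎ ∃ Q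
∀⊎∃ {zero} P⊎Q = inj₁ λ ()
∀⊎∃ {suc k} P⊎Q with P⊎Q zero | ∀⊎∃ (P⊎Q ∘ suc)
... | inj₂ q₀ | _ = inj₂ (zero , q₀)
... | inj₁ _ | inj₂ (i , qᵢ) = inj₂ (suc i , qᵢ)
... | inj₁ p₀ | inj₁ ps = inj₁ λ { zero → p₀ ; (suc i) → ps i }

module _ {k : ℕ} where

  count-∪-+-count-∩ : ∀ (p q : Subset k) →
                      count (_∈? (p ∪ q)) + count (_∈? (p ∩ q)) ≡ count (_∈? p) + count (_∈? q)
  count-∪-+-count-∩ p q = trans
    (cong₂ _+_ (count-cong (_∈? (p ∪ q)) (λ i → i ∈? p ⊎-dec i ∈? q) (x∈p∪q⁻ p q) x∈p∪q⁺)
               (count-cong (_∈? (p ∩ q)) (λ i → i ∈? p ×-dec i ∈? q) (x∈p∩q⁻ p q) x∈p∩q⁺))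
    (count-⊎-+-count-× (_∈? p) (_∈? q))

  count-remove-∈ : ∀ (p : Subset k) {i} → i ∈ₛ p → count (_∈? p) ≡ suc (count (_∈? (p ∩ ∁ ⁅ i ⁆)))
  count-remove-∈ p {i} i∈p = trans (count-remove (_∈? p) i∈p) (cong suc (count-cong
    (λ j → j ∈? p ×-dec ¬? (j ≟ i)) (_∈? (p ∩ ∁ ⁅ i ⁆))
    (λ (j∈p , j≢i) → x∈p∩q⁺ (j∈p , x∉p⇒x∈∁p (x≢y⇒x∉⁅y⁆ j≢i)))
    (λ j∈ → let j∈p , j∈∁ = x∈p∩q⁻ p _ j∈ in j∈p , λ { refl → x∈∁p⇒x∉p j∈∁ (x∈⁅x⁆ i) })))

module _ {A : Set} where

  Subsingleton : List A → Set
  Subsingleton xs = ∀ {x y} → x ∈ xs → y ∈ xs → x ≡ y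

  Distinct : List A → Set
  Distinct xs = ∃₂ λ x y → x ∈ xs × y ∈ xs × x ≢ y

  totalLength : ∀ {k} → (Fin k → List A) → ℕ
  totalLength C = sum (length ∘ C)

  unionOver : ∀ {k} → Subset k → (Fin k → List A) → List A
  unionOver [] C = []
  unionOver (inside ∷ J) C = C zero ++ unionOver J (C ∘ suc)
  unionOver (outside ∷ J) C = unionOver J (C ∘ suc)

  ∈-unionOver⁺ : ∀ {k} {J : Subset k} {C i x} → i ∈ₛ J → x ∈ C i → x ∈ unionOver J C
  ∈-unionOver⁺ here x∈ = ∈-++⁺ˡ x∈
  ∈-unionOver⁺ {J = inside ∷ J} {C} (there i∈J) x∈ = ∈-++⁺ʳ (C zero) (∈-unionOver⁺ i∈J x∈)
  ∈-unionOver⁺ {J = outside ∷ J} (there i∈J) x∈ = ∈-unionOver⁺ i∈J x∈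

  ∈-unionOver⁻ : ∀ {k} (J : Subset k) (C : Fin k → List A) {x} →
                 x ∈ unionOver J C → ∃ λ i → i ∈ₛ J × x ∈ C i
  ∈-unionOver⁻ (inside ∷ J) C x∈ with ∈-++⁻ (C zero) x∈
  ... | inj₁ x∈C₀ = zero , here , x∈C₀
  ... | inj₂ x∈rest = let i , i∈J , x∈Cᵢ = ∈-unionOver⁻ J (C ∘ suc) x∈rest in suc i , there i∈J , x∈Cᵢ
  ∈-unionOver⁻ (outside ∷ J) C x∈ =
    let i , i∈J , x∈Cᵢ = ∈-unionOver⁻ J (C ∘ suc) x∈ in suc i , there i∈J , x∈Cᵢ

module _ {A : Set} (_≟_ : DecidableEquality A) where

  subsingleton⊎distinct : ∀ xs → Subsingleton xs ⊎ Distinct xs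
  subsingleton⊎distinct [] = inj₁ λ ()
  subsingleton⊎distinct (a ∷ xs) with All.all? (_≟ a) xs
  ... | yes all≡a = inj₁ λ x∈ y∈ → trans (≡a x∈) (sym (≡a y∈))
    where
      ≡a : ∀ {x} → x ∈ a ∷ xs → x ≡ a
      ≡a (here refl) = refl
      ≡a (there x∈) = All.lookup all≡a x∈
  ... | no ¬all≡a =
    let y , y∈ , y≢a = find (¬All⇒Any¬ (_≟ a) xs ¬all≡a) in inj₂ (a , y , here refl , there y∈ , y≢a ∘ sym)

  without : ∀ {k} → (Fin k → List A) → Fin k → A → Fin k → List A
  without C i x = updateAt C i (filter (¬? ∘ (_≟ x)))

  module _ {k} (C : Fin k → List A) (i : Fin k) (x : A) where

    without-⊆ : ∀ j → without C i x j ⊆ C j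
    without-⊆ j e∈ with j Fin.≟ i
    ... | yes refl = proj₁ (∈-filter⁻ (¬? ∘ (_≟ x)) (subst (_ ∈_) (updateAt-updates i C) e∈))
    ... | no j≢i = subst (_ ∈_) (updateAt-minimal j i C j≢i) e∈

    ∈-without-other : ∀ {j e} → j ≢ i → e ∈ C j → e ∈ without C i x j
    ∈-without-other {j} j≢i e∈ = subst (_ ∈_) (sym (updateAt-minimal j i C j≢i)) e∈

    ∈-without-self : ∀ {e} → e ≢ x → e ∈ C i → e ∈ without C i x i
    ∈-without-self e≢x e∈ = subst (_ ∈_) (sym (updateAt-updates i C)) (∈-filter⁺ (¬? ∘ (_≟ x)) e∈ e≢x)

  totalLength-without : ∀ {k} (C : Fin k → List A) {i x} → x ∈ C i →
                        totalLength (without C i x) < totalLength C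
  totalLength-without {suc k} C {i} {x} x∈ = begin-strict
    totalLength (without C i x)
      ≡⟨ sum-remove {i = i} (length ∘ without C i x) ⟩
    length (without C i x i) + sum (length ∘ without C i x ∘ punchIn i)
      ≡⟨ cong (length (without C i x i) +_) (sum-cong-≗ others-unchanged) ⟩
    length (without C i x i) + sum (length ∘ C ∘ punchIn i)
      <⟨ ℕ.+-monoˡ-< _ shorter ⟩
    length (C i) + sum (length ∘ C ∘ punchIn i)
      ≡⟨ sum-remove {i = i} (length ∘ C) ⟨
    totalLength C
      ∎
    where
      open ℕ.≤-Reasoning
      others-unchanged : ∀ j → length (without C i x (punchIn i j)) ≡ length (C (punchIn i j))
      others-unchanged j = cong length (updateAt-minimal (punchIn i j) i C (Fin.punchInᵢ≢i i j))
      shorter : length (without C i x i) < length (C i)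
      shorter = subst (λ l → length l < length (C i)) (sym (updateAt-updates i C))
                      (filter-notAll (¬? ∘ (_≟ x)) (C i) (lose x∈ λ x≢x → x≢x refl))

-- Walks and connected components

Edge : ℕ → Set
Edge n = Fin n × Fin n

_≟ₑ_ : ∀ {n} → DecidableEquality (Edge n)
_≟ₑ_ = ≡-dec _≟_ _≟_

module _ {n : ℕ} where

  Step : List (Edge n) → Fin n → Fin n → Set
  Step E u v = (u , v) ∈ E ⊎ (v , u) ∈ E

  Walk : List (Edge n) → Fin n → Fin n → Set
  Walk E = Star (Step E)

  walk-sym : ∀ {E u v} → Walk E u v → Walk E v u
  walk-sym = Star.reverse [ inj₂ , inj₁ ]′

  walk-mono : ∀ {E E′} → E ⊆ E′ → ∀ {u v} → Walk E u v → Walk E′ u v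
  walk-mono E⊆E′ = Star.map [ inj₁ ∘ E⊆E′ , inj₂ ∘ E⊆E′ ]′

  walk-edge : ∀ {E a b} → (a , b) ∈ E → Walk E a b
  walk-edge ab∈E = inj₁ ab∈E ◅ ε

  walk-[] : ∀ {u v} → Walk [] u v → u ≡ v
  walk-[] ε = refl
  walk-[] (inj₁ () ◅ _)
  walk-[] (inj₂ () ◅ _)

  Near : List (Edge n) → Edge n → Fin n → Set
  Near E (a , b) x = Walk E x a ⊎ Walk E x b

  private
    WalkVia : List (Edge n) → Edge n → Fin n → Fin n → Set
    WalkVia E e u v = Walk E u v ⊎ (Near E e u × Near E e v)

    near-◅◅ : ∀ {E e u v} → Walk E u v → Near E e v → Near E e u
    near-◅◅ w (inj₁ va) = inj₁ (w ◅◅ va)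
    near-◅◅ w (inj₂ vb) = inj₂ (w ◅◅ vb)

    via-trans : ∀ {E e u v w} → WalkVia E e u v → WalkVia E e v w → WalkVia E e u w
    via-trans (inj₁ uv) (inj₁ vw) = inj₁ (uv ◅◅ vw)
    via-trans (inj₁ uv) (inj₂ (v∼ , w∼)) = inj₂ (near-◅◅ uv v∼ , w∼)
    via-trans (inj₂ (u∼ , v∼)) (inj₁ vw) = inj₂ (u∼ , near-◅◅ (walk-sym vw) v∼)
    via-trans (inj₂ (u∼ , _)) (inj₂ (_ , w∼)) = inj₂ (u∼ , w∼)

    via-step : ∀ {E a b u v} → Step ((a , b) ∷ E) u v → WalkVia E (a , b) u v
    via-step (inj₁ (here refl)) = inj₂ (inj₁ ε , inj₂ ε)
    via-step (inj₂ (here refl)) = inj₂ (inj₂ ε , inj₁ ε)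
    via-step (inj₁ (there uv∈E)) = inj₁ (inj₁ uv∈E ◅ ε)
    via-step (inj₂ (there vu∈E)) = inj₁ (inj₂ vu∈E ◅ ε)

  walk-∷⁻ : ∀ {E a b u v} → Walk ((a , b) ∷ E) u v → Walk E u v ⊎ (Near E (a , b) u × Near E (a , b) v)
  walk-∷⁻ ε = inj₁ ε
  walk-∷⁻ (s ◅ w) = via-trans (via-step s) (walk-∷⁻ w)

  walk-∷⁺ : ∀ {E a b u v} → Walk E u v ⊎ (Near E (a , b) u × Near E (a , b) v) → Walk ((a , b) ∷ E) u v
  walk-∷⁺ (inj₁ uv) = walk-mono there uv
  walk-∷⁺ {a = a} {b} (inj₂ (u∼ , v∼)) = to-edge u∼ ◅◅ walk-sym (to-edge v∼)
    where
      ab : Walk ((a , b) ∷ _) a b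
      ab = walk-edge (here refl)
      to-edge : ∀ {x} → Near _ (a , b) x → Walk ((a , b) ∷ _) x a
      to-edge (inj₁ xa) = walk-mono there xa
      to-edge (inj₂ xb) = walk-mono there xb ◅◅ walk-sym ab

  walk-∷-redundant : ∀ {E a b u v} → Walk E a b → Walk ((a , b) ∷ E) u v → Walk E u v
  walk-∷-redundant {E} {a} {b} ab = [ id , (λ (u∼ , v∼) → to-a u∼ ◅◅ walk-sym (to-a v∼)) ]′ ∘ walk-∷⁻
    where
      to-a : ∀ {x} → Near E (a , b) x → Walk E x a
      to-a (inj₁ xa) = xa
      to-a (inj₂ xb) = xb ◅◅ walk-sym ab

  walk-∷-cong : ∀ {E F e u v} → (∀ {x y} → Walk E x y → Walk F x y) → Walk (e ∷ E) u v → Walk (e ∷ F) u v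
  walk-∷-cong E⇒F = walk-∷⁺ ∘ Sum.map E⇒F (Product.map near near) ∘ walk-∷⁻
    where
      near : ∀ {x} → Near _ _ x → Near _ _ x
      near = Sum.map E⇒F E⇒F

  walk? : ∀ E u v → Dec (Walk E u v)
  walk? [] u v = map′ (λ { refl → ε }) walk-[] (u ≟ v)
  walk? ((a , b) ∷ E) u v = map′ walk-∷⁺ walk-∷⁻
    (walk? E u v ⊎-dec ((walk? E u a ⊎-dec walk? E u b) ×-dec (walk? E v a ⊎-dec walk? E v b)))

module _ {n : ℕ} where

  IsRoot : List (Edge n) → Pred (Fin n) 0ℓ
  IsRoot E v = ∀ w → Walk E w v → v Fin.≤ w

  isRoot? : ∀ E → Decidable (IsRoot E)
  isRoot? E v = Fin.all? (λ w → walk? E w v →-dec v Fin.≤? w)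

  components : List (Edge n) → ℕ
  components E = count (isRoot? E)

  root : List (Edge n) → Fin n → Fin n
  root E v = proj₁ (least (λ w → walk? E w v) ε)

  walk-root : ∀ E v → Walk E (root E v) v
  walk-root E v = proj₁ (proj₂ (least (λ w → walk? E w v) ε))

  root-≤ : ∀ E {v w} → Walk E w v → root E v Fin.≤ w
  root-≤ E {v} = proj₂ (proj₂ (least (λ w → walk? E w v) ε))

  root-isRoot : ∀ E v → IsRoot E (root E v)
  root-isRoot E v w w∼root = root-≤ E (w∼root ◅◅ walk-root E v)

  roots-linked : ∀ {E u v} → IsRoot E u → IsRoot E v → Walk E u v → u ≡ v
  roots-linked u-root v-root uv = Fin.≤-antisym (u-root _ (walk-sym uv)) (v-root _ uv)

  isRoot⇒≡root : ∀ {E v x} → IsRoot E v → Walk E v x → v ≡ root E x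
  isRoot⇒≡root {E} {x = x} v-root vx = roots-linked v-root (root-isRoot E x) (vx ◅◅ walk-sym (walk-root E x))

  components-cong : ∀ {E E′} → (∀ {u v} → Walk E u v → Walk E′ u v) → (∀ {u v} → Walk E′ u v → Walk E u v) →
                    components E ≡ components E′
  components-cong E⇒E′ E′⇒E =
    count-cong (isRoot? _) (isRoot? _) (λ v-root w → v-root w ∘ E′⇒E) (λ v-root w → v-root w ∘ E⇒E′)

  components-[] : components [] ≡ n
  components-[] = count-all (isRoot? []) (λ v w wv → Fin.≤-reflexive (sym (walk-[] wv)))

  components-∷-linked : ∀ {E a b} → Walk E a b → components ((a , b) ∷ E) ≡ components E
  components-∷-linked ab = components-cong (walk-∷-redundant ab) (walk-mono there)

  private
    swap-step : ∀ {E : List (Edge n)} {a b u v} → Step ((a , b) ∷ E) u v → Step ((b , a) ∷ E) u v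
    swap-step (inj₁ (here refl)) = inj₂ (here refl)
    swap-step (inj₂ (here refl)) = inj₁ (here refl)
    swap-step (inj₁ (there uv∈E)) = inj₁ (there uv∈E)
    swap-step (inj₂ (there vu∈E)) = inj₂ (there vu∈E)

    -- Only the larger root, root E b, stops being a root.
    joining-roots : ∀ {E a b} → root E a Fin.< root E b → components E ≡ suc (components ((a , b) ∷ E))
    joining-roots {E} {a} {b} ra<rb = trans (count-remove (isRoot? E) (root-isRoot E b))
      (cong suc (count-cong (λ v → isRoot? E v ×-dec ¬? (v ≟ root E b)) (isRoot? ((a , b) ∷ E)) from to))
      where
        ra∼rb : Walk ((a , b) ∷ E) (root E a) (root E b)
        ra∼rb = walk-mono there (walk-root E a) ◅◅ walk-edge (here refl) ◅◅
                walk-mono there (walk-sym (walk-root E b))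
        to : ∀ {v} → IsRoot ((a , b) ∷ E) v → IsRoot E v × v ≢ root E b
        to v-root = (λ w → v-root w ∘ walk-mono there) , λ { refl → ℕ.<⇒≱ ra<rb (v-root _ ra∼rb) }
        from : ∀ {v} → IsRoot E v × v ≢ root E b → IsRoot ((a , b) ∷ E) v
        from (v-root , v≢rb) w wv with walk-∷⁻ wv
        ... | inj₁ wv′ = v-root w wv′
        ... | inj₂ (_ , inj₂ vb) = contradiction (isRoot⇒≡root v-root vb) v≢rb
        ... | inj₂ (inj₁ wa , inj₁ va) rewrite isRoot⇒≡root v-root va = root-≤ E wa
        ... | inj₂ (inj₂ wb , inj₁ va) rewrite isRoot⇒≡root v-root va = ℕ.<⇒≤ (ℕ.<-≤-trans ra<rb (root-≤ E wb))

  components-∷-unlinked : ∀ {E a b} → ¬ Walk E a b → components E ≡ suc (components ((a , b) ∷ E))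
  components-∷-unlinked {E} {a} {b} ¬ab with Fin.<-cmp (root E a) (root E b)
  ... | tri< ra<rb _ _ = joining-roots ra<rb
  ... | tri> _ _ rb<ra =
    trans (joining-roots rb<ra) (cong suc (components-cong (Star.map swap-step) (Star.map swap-step)))
  ... | tri≈ _ ra≡rb _ =
    contradiction (walk-sym (walk-root E a) ◅◅ subst (λ r → Walk E r b) (sym ra≡rb) (walk-root E b)) ¬ab

  linked⇒components≤1 : ∀ {E} → (∀ u v → Walk E u v) → components E ≤ 1
  linked⇒components≤1 {E} linked =
    count≤1 (isRoot? E) (λ u-root v-root → roots-linked u-root v-root (linked _ _))

  components≤1⇒linked : ∀ {E} → components E ≤ 1 → ∀ u v → Walk E u v
  components≤1⇒linked {E} ≤1 u v with walk? E u v
  ... | yes uv = uv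
  ... | no ¬uv = contradiction
    (injection⇒≤count (isRoot? E) two-roots two-roots-injective (root-isRoot E ∘ ends)) (ℕ.<⇒≱ (s≤s ≤1))
    where
      ends : Fin 2 → Fin n
      ends zero = u
      ends (suc zero) = v
      two-roots : Fin 2 → Fin n
      two-roots = root E ∘ ends
      ru≢rv : root E u ≢ root E v
      ru≢rv ru≡rv = ¬uv (walk-sym (walk-root E u) ◅◅ subst (λ r → Walk E r v) (sym ru≡rv) (walk-root E v))
      two-roots-injective : ∀ {i j} → two-roots i ≡ two-roots j → i ≡ j
      two-roots-injective {zero} {zero} _ = refl
      two-roots-injective {zero} {suc zero} eq = contradiction eq ru≢rv
      two-roots-injective {suc zero} {zero} eq = contradiction (sym eq) ru≢rv
      two-roots-injective {suc zero} {suc zero} _ = refl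

  components-∷-≤ : ∀ {E} e → components (e ∷ E) ≤ components E
  components-∷-≤ {E} (a , b) with walk? E a b
  ... | yes ab = ℕ.≤-reflexive (components-∷-linked ab)
  ... | no ¬ab = ℕ.≤-trans (ℕ.n≤1+n _) (ℕ.≤-reflexive (sym (components-∷-unlinked ¬ab)))

  components-∷-≥ : ∀ {E} e → components E ≤ suc (components (e ∷ E))
  components-∷-≥ {E} (a , b) with walk? E a b
  ... | yes ab = ℕ.≤-trans (ℕ.≤-reflexive (sym (components-∷-linked ab))) (ℕ.n≤1+n _)
  ... | no ¬ab = ℕ.≤-reflexive (components-∷-unlinked ¬ab)

  n≤components+length : ∀ E → n ≤ components E + length E
  n≤components+length [] = ℕ.≤-reflexive (trans (sym components-[]) (sym (ℕ.+-identityʳ _)))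
  n≤components+length (e ∷ E) = ℕ.≤-trans (n≤components+length E)
    (ℕ.≤-trans (ℕ.+-monoˡ-≤ (length E) (components-∷-≥ e)) (ℕ.≤-reflexive (sym (ℕ.+-suc _ _))))

  components-≈ : ∀ {E E′} → E ⊆ E′ → E′ ⊆ E → components E ≡ components E′
  components-≈ E⊆E′ E′⊆E = components-cong (walk-mono E⊆E′) (walk-mono E′⊆E)

  components-++-≤ : ∀ D E → components (D ++ E) ≤ components E
  components-++-≤ [] E = ℕ.≤-refl
  components-++-≤ (e ∷ D) E = ℕ.≤-trans (components-∷-≤ e) (components-++-≤ D E)

  components-antitone : ∀ {E E′} → E ⊆ E′ → components E′ ≤ components E
  components-antitone {E} {E′} E⊆E′ = begin
    components E′        ≡⟨ components-≈ (xs⊆xs++ys E′ E) ([ id , E⊆E′ ]′ ∘ ∈-++⁻ E′) ⟩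
    components (E′ ++ E) ≤⟨ components-++-≤ E′ E ⟩
    components E         ∎
    where open ℕ.≤-Reasoning

  -- Adding edges D lowers the number of components of a subgraph at least as much as that of the whole graph.
  components-diminishing : ∀ {E E′} → E ⊆ E′ → ∀ D →
                           components E′ + components (D ++ E) ≤ components E + components (D ++ E′)
  components-diminishing {E} {E′} _ [] = ℕ.≤-reflexive (ℕ.+-comm (components E′) (components E))
  components-diminishing {E} {E′} E⊆E′ ((a , b) ∷ D) with walk? (D ++ E′) a b
  ... | yes ab′ = begin
    components E′ + components ((a , b) ∷ D ++ E) ≤⟨ ℕ.+-monoʳ-≤ (components E′) (components-∷-≤ (a , b)) ⟩
    components E′ + components (D ++ E)           ≤⟨ components-diminishing E⊆E′ D ⟩
    components E + components (D ++ E′)           ≡⟨ cong (components E +_) (components-∷-linked ab′) ⟨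
    components E + components ((a , b) ∷ D ++ E′) ∎
    where open ℕ.≤-Reasoning
  ... | no ¬ab′ = ℕ.+-cancelˡ-≤ 1 _ _ (begin
    suc (components E′ + components ((a , b) ∷ D ++ E)) ≡⟨ ℕ.+-suc _ _ ⟨
    components E′ + suc (components ((a , b) ∷ D ++ E)) ≡⟨ cong (components E′ +_) (components-∷-unlinked ¬ab) ⟨
    components E′ + components (D ++ E)                 ≤⟨ components-diminishing E⊆E′ D ⟩
    components E + components (D ++ E′)                 ≡⟨ cong (components E +_) (components-∷-unlinked ¬ab′) ⟩
    components E + suc (components ((a , b) ∷ D ++ E′)) ≡⟨ ℕ.+-suc _ _ ⟩
    suc (components E + components ((a , b) ∷ D ++ E′)) ∎)
    where
      open ℕ.≤-Reasoning
      ¬ab : ¬ Walk (D ++ E) a b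
      ¬ab = ¬ab′ ∘ walk-mono (++⁺ʳ D E⊆E′)

  components-submodular : ∀ {X Y Z} → Z ⊆ X → Z ⊆ Y →
                          components X + components Y ≤ components Z + components (X ++ Y)
  components-submodular {X} {Y} {Z} Z⊆X Z⊆Y = begin
    components X + components Y        ≡⟨ ℕ.+-comm (components X) (components Y) ⟩
    components Y + components X        ≡⟨ cong (components Y +_) X≈X++Z ⟩
    components Y + components (X ++ Z) ≤⟨ components-diminishing Z⊆Y X ⟩
    components Z + components (X ++ Y) ∎
    where
      open ℕ.≤-Reasoning
      X≈X++Z : components X ≡ components (X ++ Z)
      X≈X++Z = components-≈ (xs⊆xs++ys X Z) ([ id , Z⊆X ]′ ∘ ∈-++⁻ X)

module _ {n : ℕ} (E : List (Edge n)) where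

  open Enumeration (enumerate (isRoot? E))

  componentLabel : Fin n → Fin (components E)
  componentLabel v = proj₁ (at-surjective (root-isRoot E v))

  walk⇒same-label : ∀ {u v} → Walk E u v → componentLabel u ≡ componentLabel v
  walk⇒same-label {u} {v} uv = at-injective (begin
    at (componentLabel u) ≡⟨ proj₂ (at-surjective (root-isRoot E u)) ⟩
    root E u              ≡⟨ isRoot⇒≡root (root-isRoot E u) (walk-root E u ◅◅ uv) ⟩
    root E v              ≡⟨ proj₂ (at-surjective (root-isRoot E v)) ⟨
    at (componentLabel v) ∎)
    where open ≡-Reasoning

  componentPartition : Partition n (components E)
  componentPartition = record { label = componentLabel ; surj = λ k → at k , λ { refl → labels-roots k } }
    where
      labels-roots : ∀ k → componentLabel (at k) ≡ k
      labels-roots k = at-injective (trans (proj₂ (at-surjective (root-isRoot E (at k))))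
                                           (sym (isRoot⇒≡root (at-satisfies k) ε)))

-- Multigraphs given by the ends of their edges

star-along : ∀ {A : Set} {R : A → A → Set} s (w : Fin (suc s) → A) →
             (∀ i → R (w (inject₁ i)) (w (suc i))) → Star R (w zero) (w (fromℕ s))
star-along zero w steps = ε
star-along (suc s) w steps = steps zero ◅ star-along s (w ∘ suc) (steps ∘ suc)

module _ {n ℓ : ℕ} (ends : Fin ℓ → Edge n) where

  joins⇒step : ∀ {i a b} → Joins (ends i) a b → Step (tabulate ends) a b
  joins⇒step {i} (inj₁ eq) = inj₁ (subst (_∈ tabulate ends) eq (∈-tabulate⁺ i))
  joins⇒step {i} (inj₂ eq) = inj₂ (subst (_∈ tabulate ends) eq (∈-tabulate⁺ i))

  connected⇒linked : Connected ends → ∀ u v → Walk (tabulate ends) u v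
  connected⇒linked connected u v = Star.map (λ (i , joins) → joins⇒step joins) (connected u v)

  linked⇒connected : (∀ u v → Walk (tabulate ends) u v) → Connected ends
  linked⇒connected linked u v = Star.map adjacent (linked u v)
    where
      adjacent : ∀ {a b} → Step (tabulate ends) a b → Adjacent ends a b
      adjacent (inj₁ ab∈) = let i , eq = ∈-tabulate⁻ ab∈ in i , inj₁ (sym eq)
      adjacent (inj₂ ba∈) = let i , eq = ∈-tabulate⁻ ba∈ in i , inj₂ (sym eq)

module _ {n ℓ : ℕ} (ends : Fin (suc ℓ) → Edge n) (p : Fin (suc ℓ)) where

  others : List (Edge n)
  others = tabulate (ends ∘ punchIn p)

  others-∈ : ∀ {q} → q ≢ p → ends q ∈ others
  others-∈ q≢p =
    subst (λ r → ends r ∈ others) (Fin.punchIn-punchOut (q≢p ∘ sym)) (∈-tabulate⁺ (punchOut (q≢p ∘ sym)))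

  tabulate-⊆ : tabulate ends ⊆ ends p ∷ others
  tabulate-⊆ e∈ with ∈-tabulate⁻ {f = ends} e∈
  ... | q , refl with q ≟ p
  ...   | yes refl = here refl
  ...   | no q≢p = there (others-∈ q≢p)

  tabulate-⊇ : ends p ∷ others ⊆ tabulate ends
  tabulate-⊇ (here refl) = ∈-tabulate⁺ {f = ends} p
  tabulate-⊇ (there e∈) with ∈-tabulate⁻ {f = ends ∘ punchIn p} e∈
  ... | q , refl = ∈-tabulate⁺ {f = ends} (punchIn p q)

  joins⇒others-step : ∀ {q a b} → q ≢ p → Joins (ends q) a b → Step others a b
  joins⇒others-step q≢p (inj₁ eq) = inj₁ (subst (_∈ others) eq (others-∈ q≢p))
  joins⇒others-step q≢p (inj₂ eq) = inj₂ (subst (_∈ others) eq (others-∈ q≢p))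

cycle⇒redundant-edge : ∀ {n ℓ} (ends : Fin (suc ℓ) → Edge n) → Cycle ends →
                       ∃ λ p → Walk (others ends p) (proj₁ (ends p)) (proj₂ (ends p))
cycle⇒redundant-edge ends (k , w , g , g-injective , _ , closed , joins) = g zero , first-edge-redundant
  where
    around : Walk (others ends (g zero)) (w (suc zero)) (w zero)
    around = subst (Walk _ _) (sym closed) (star-along k (w ∘ suc) λ i →
      joins⇒others-step ends (g zero) (Fin.0≢1+n ∘ g-injective ∘ sym) (joins (suc i)))
    first-edge-redundant : Walk (others ends (g zero)) (proj₁ (ends (g zero))) (proj₂ (ends (g zero)))
    first-edge-redundant with joins zero
    ... | inj₁ eq rewrite eq = walk-sym around
    ... | inj₂ eq rewrite eq = around

components+size≡n⇒acyclic : ∀ {n ℓ} (ends : Fin ℓ → Edge n) →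
                             components (tabulate ends) + ℓ ≡ n → Acyclic ends
components+size≡n⇒acyclic {ℓ = zero} ends _ (_ , _ , g , _) with g zero
... | ()
components+size≡n⇒acyclic {n} {suc ℓ} ends independent cycle = ℕ.<-irrefl refl (begin-strict
  n                                                   ≤⟨ n≤components+length (others ends p) ⟩
  components (others ends p) + length (others ends p) ≡⟨ cong₂ _+_ (sym same) (length-tabulate _) ⟩
  components (tabulate ends) + ℓ                      <⟨ ℕ.+-monoʳ-< _ (ℕ.n<1+n ℓ) ⟩
  components (tabulate ends) + suc ℓ                  ≡⟨ independent ⟩
  n                                                   ∎)
  where
    open ℕ.≤-Reasoning
    p : Fin (suc ℓ)
    p = proj₁ (cycle⇒redundant-edge ends cycle)
    same : components (tabulate ends) ≡ components (others ends p)
    same = trans (components-≈ (tabulate-⊆ ends p) (tabulate-⊇ ends p))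
                 (components-∷-linked (proj₂ (cycle⇒redundant-edge ends cycle)))

NonLoop : ∀ {n ℓ} → (Fin ℓ → Edge n) → Fin ℓ → Set
NonLoop ends i = proj₁ (ends i) ≢ proj₂ (ends i)

nonLoop? : ∀ {n ℓ} (ends : Fin ℓ → Edge n) → Decidable (NonLoop ends)
nonLoop? ends i = ¬? (proj₁ (ends i) ≟ proj₂ (ends i))

n≤components+nonLoops : ∀ {n ℓ} (ends : Fin ℓ → Edge n) →
                        n ≤ components (tabulate ends) + count (nonLoop? ends)
n≤components+nonLoops {ℓ = zero} ends = ℕ.≤-reflexive (trans (sym components-[]) (sym (ℕ.+-identityʳ _)))
n≤components+nonLoops {ℓ = suc ℓ} ends with proj₁ (ends zero) ≟ proj₂ (ends zero)
... | yes loop = ℕ.≤-trans (n≤components+nonLoops (ends ∘ suc))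
  (ℕ.≤-reflexive (cong (_+ count (nonLoop? (ends ∘ suc)))
                       (sym (components-∷-linked (subst (Walk _ _) loop ε)))))
... | no _ = ℕ.≤-trans (n≤components+nonLoops (ends ∘ suc))
  (ℕ.≤-trans (ℕ.+-monoˡ-≤ _ (components-∷-≥ (ends zero))) (ℕ.≤-reflexive (sym (ℕ.+-suc _ _))))

quotient-connected : ∀ {n k ℓ} (ends : Fin ℓ → Edge n) (P : Partition n k) →
                     Connected ends → Connected (Product.map (label P) (label P) ∘ ends)
quotient-connected ends P connected x y with surj P x | surj P y
... | u , u↦x | v , v↦y = subst₂ (Star _) (u↦x refl) (v↦y refl)
  (Star.gmap (label P) (λ (i , joins) → i , Sum.map (cong _) (cong _) joins) (connected u v))

DistinctLabels : ∀ {I B : Set} → List (I × B) → Set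
DistinctLabels = AllPairs (λ x y → proj₁ x ≢ proj₁ y)

lookup-label-injective : ∀ {I B : Set} (xs : List (I × B)) → DistinctLabels xs →
                         ∀ {p q} → proj₁ (lookup xs p) ≡ proj₁ (lookup xs q) → p ≡ q
lookup-label-injective (x ∷ xs) (_ ∷ _) {zero} {zero} _ = refl
lookup-label-injective (x ∷ xs) (x# ∷ _) {zero} {suc q} eq = contradiction eq (All.lookup x# (∈-lookup q))
lookup-label-injective (x ∷ xs) (x# ∷ _) {suc p} {zero} eq = contradiction (sym eq) (All.lookup x# (∈-lookup p))
lookup-label-injective (x ∷ xs) (_ ∷ xs#) {suc p} {suc q} eq = cong suc (lookup-label-injective xs xs# eq)

module _ {n : ℕ} {I : Set} where

  record SpanningForest (L : List (I × Edge n)) : Set where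
    field
      forest      : List (I × Edge n)
      forest-⊆    : forest ⊆ L
      distinct    : DistinctLabels forest
      spans       : ∀ {u v} → Walk (map proj₂ L) u v → Walk (map proj₂ forest) u v
      independent : components (map proj₂ forest) + length forest ≡ n

  -- Greedily keep every edge whose ends are not yet joined.  An edge with the label of a kept edge is
  -- that same edge, hence already joined, so kept labels are distinct.
  spanningForest : (L : List (I × Edge n)) → (∀ {i e e′} → (i , e) ∈ L → (i , e′) ∈ L → e ≡ e′) →
                   SpanningForest L
  spanningForest [] _ = record
    { forest = [] ; forest-⊆ = λ () ; distinct = [] ; spans = λ w → w
    ; independent = trans (ℕ.+-identityʳ _) components-[] }
  spanningForest ((i , (a , b)) ∷ L) functional
    with spanningForest L (λ ie ie′ → functional (there ie) (there ie′))
  ... | F with walk? (map proj₂ (SpanningForest.forest F)) a b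
  ...   | yes ab = record
    { forest = forest ; forest-⊆ = there ∘ forest-⊆ ; distinct = distinct
    ; spans = walk-∷-redundant ab ∘ walk-∷-cong spans ; independent = independent }
    where open SpanningForest F
  ...   | no ¬ab = record
    { forest = (i , (a , b)) ∷ forest
    ; forest-⊆ = λ { (here refl) → here refl ; (there x∈) → there (forest-⊆ x∈) }
    ; distinct = All.tabulate new-label ∷ distinct
    ; spans = walk-∷-cong spans
    ; independent =
        trans (ℕ.+-suc _ _) (trans (cong (_+ length forest) (sym (components-∷-unlinked ¬ab))) independent) }
    where
      open SpanningForest F
      new-label : ∀ {x} → x ∈ forest → i ≢ proj₁ x
      new-label {j , e} x∈ refl with functional (here refl) (there (forest-⊆ x∈))
      ... | refl = ¬ab (walk-edge (∈-map⁺ proj₂ x∈))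

-- Trimmings of hedgegraphs

module _ (G : Hedgegraph) where

  Candidates : Set
  Candidates = Fin (m G) → List (Edge (n G))

  spanningTreeTrimming⇒onePartitionConnected : HasSpanningTreeTrimming G → OnePartitionConnected G
  spanningTreeTrimming⇒onePartitionConnected (ℓ , f , f-injective , ends , trimming , connected , _) k P =
    f ∘ pick , pick-injective ∘ f-injective , crosses
    where
      quotient : Fin ℓ → Edge k
      quotient = Product.map (label P) (label P) ∘ ends
      at-most-one : components (tabulate quotient) ≤ 1
      at-most-one = linked⇒components≤1 (connected⇒linked quotient (quotient-connected ends P connected))
      k∸1≤nonLoops : k ∸ 1 ≤ count (nonLoop? quotient)
      k∸1≤nonLoops = ℕ.m≤n+o⇒m∸n≤o k 1
        (ℕ.≤-trans (n≤components+nonLoops quotient) (ℕ.+-monoˡ-≤ _ at-most-one))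
      selection : Σ (Fin (k ∸ 1) → Fin ℓ) λ pick →
                  Injective _≡_ _≡_ pick × (∀ j → NonLoop quotient (pick j))
      selection = ≤count⇒injection (nonLoop? quotient) k∸1≤nonLoops
      pick : Fin (k ∸ 1) → Fin ℓ
      pick = proj₁ selection
      pick-injective : Injective _≡_ _≡_ pick
      pick-injective = proj₁ (proj₂ selection)
      crosses : ∀ j → Crosses G P (f (pick j))
      crosses j = let h , h∈ , u∈h , v∈h , _ = trimming (pick j)
                  in h , h∈ , _ , _ , u∈h , v∈h , proj₂ (proj₂ selection) j

  Trims : Fin (m G) → Edge (n G) → Set
  Trims i (u , v) = ∃[ h ] (h ∈ hedge G i × u ∈ₛ h × v ∈ₛ h × u ≢ v)

  trims? : ∀ i → Decidable (Trims i)
  trims? i (u , v) = map′ find (λ (h , h∈ , ends∈h) → lose h∈ ends∈h)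
    (any? (λ h → u ∈? h ×-dec v ∈? h ×-dec ¬? (u ≟ v)) (hedge G i))

  trimmings : Candidates
  trimmings i = filter (trims? i) (cartesianProduct (allFin _) (allFin _))

  trimmings-sound : ∀ {i e} → e ∈ trimmings i → Trims i e
  trimmings-sound {i} e∈ = proj₂ (∈-filter⁻ (trims? i) {xs = cartesianProduct (allFin _) (allFin _)} e∈)

  trimmings-complete : ∀ {i e} → Trims i e → e ∈ trimmings i
  trimmings-complete {i} {u , v} =
    ∈-filter⁺ (trims? i) (∈-cartesianProduct⁺ (∈-allFin u) (∈-allFin v))

  -- Rado's condition: the candidate edges of any set J of hedges form a graph with at most
  -- one component more than there are hedges outside J.
  Rado : Candidates → Set
  Rado C = ∀ J → components (unionOver J C) + count (_∈? J) ≤ suc (m G)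

  onePartitionConnected⇒rado : OnePartitionConnected G → Rado trimmings
  onePartitionConnected⇒rado opc J = begin
    k + count (_∈? J)                          ≤⟨ ℕ.+-monoˡ-≤ _ (ℕ.m≤n+m∸n k 1) ⟩
    suc (k ∸ 1 + count (_∈? J))                ≤⟨ ℕ.s≤s (ℕ.+-monoˡ-≤ _ crossing≤outside) ⟩
    suc (count (¬? ∘ (_∈? J)) + count (_∈? J)) ≡⟨ cong suc (ℕ.+-comm (count (¬? ∘ (_∈? J))) _) ⟩
    suc (count (_∈? J) + count (¬? ∘ (_∈? J))) ≡⟨ cong suc (count-+-count-¬ (_∈? J)) ⟩
    suc (m G)                                  ∎
    where
      open ℕ.≤-Reasoning
      E : List (Edge (n G))
      E = unionOver J trimmings
      k : ℕ
      k = components E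
      crossing : Σ (Fin (k ∸ 1) → Fin (m G)) λ f →
                 Injective _≡_ _≡_ f × (∀ j → Crosses G (componentPartition E) (f j))
      crossing = opc k (componentPartition E)
      crossing⇒∉J : ∀ j → proj₁ crossing j ∉ₛ J
      crossing⇒∉J j j∈J with proj₂ (proj₂ crossing) j
      ... | h , h∈ , u , v , u∈h , v∈h , labels≢ = labels≢ (walk⇒same-label E (walk-edge (∈-unionOver⁺ j∈J
              (trimmings-complete (h , h∈ , u∈h , v∈h , labels≢ ∘ cong (componentLabel E))))))
      crossing≤outside : k ∸ 1 ≤ count (¬? ∘ (_∈? J))
      crossing≤outside = injection⇒≤count (¬? ∘ (_∈? J)) (proj₁ crossing) (proj₁ (proj₂ crossing)) crossing⇒∉J

  Violated : Candidates → Subset (m G) → Set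
  Violated C J = suc (m G) < components (unionOver J C) + count (_∈? J)

  rado⊎violated : ∀ C → Rado C ⊎ ∃ (Violated C)
  rado⊎violated C with anySubset? (λ J → suc (m G) <? components (unionOver J C) + count (_∈? J))
  ... | yes violated = inj₂ violated
  ... | no none = inj₁ λ J → ℕ.≮⇒≥ (none ∘ (J ,_))

  violated-∋ : ∀ {C i x J} → Rado C → Violated (without _≟ₑ_ C i x) J → i ∈ₛ J
  violated-∋ {C} {i} {x} {J} rado violated with i ∈? J
  ... | yes i∈J = i∈J
  ... | no i∉J = contradiction (subst (λ c → c + count (_∈? J) ≤ suc (m G)) same (rado J)) (ℕ.<⇒≱ violated)
    where
      same : components (unionOver J C) ≡ components (unionOver J (without _≟ₑ_ C i x))
      same = components-≈
        (λ e∈ → let j , j∈J , e∈Cⱼ = ∈-unionOver⁻ J _ e∈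
                in ∈-unionOver⁺ j∈J (∈-without-other _≟ₑ_ C i x (λ { refl → i∉J j∈J }) e∈Cⱼ))
        (λ e∈ → let j , j∈J , e∈Cⱼ = ∈-unionOver⁻ J _ e∈ in ∈-unionOver⁺ j∈J (without-⊆ _≟ₑ_ C i x j e∈Cⱼ))

  -- Welsh's argument: if deleting either of two candidates of hedge i violates Rado's condition, at sets
  -- J₁ and J₂, then submodularity of the component count applied to J₁ ∩ J₂ ∖ {i} and J₁ ∪ J₂
  -- contradicts Rado's condition for C itself.
  module _ {C : Candidates} (rado : Rado C) {i x y} (x≢y : x ≢ y) {J₁ J₂}
           (violated₁ : Violated (without _≟ₑ_ C i x) J₁) (violated₂ : Violated (without _≟ₑ_ C i y) J₂) where

    private
      J₃ J₄ : Subset (m G)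
      J₃ = (J₁ ∩ J₂) ∩ ∁ ⁅ i ⁆
      J₄ = J₁ ∪ J₂

      X Y Z W : List (Edge (n G))
      X = unionOver J₁ (without _≟ₑ_ C i x)
      Y = unionOver J₂ (without _≟ₑ_ C i y)
      Z = unionOver J₃ C
      W = unionOver J₄ C

      i∈J₁ : i ∈ₛ J₁
      i∈J₁ = violated-∋ rado violated₁
      i∈J₂ : i ∈ₛ J₂
      i∈J₂ = violated-∋ rado violated₂

      ∈J₃ : ∀ {j} → j ∈ₛ J₃ → j ∈ₛ J₁ × j ∈ₛ J₂ × j ≢ i
      ∈J₃ j∈ = let j∈J₁∩J₂ , j∈∁ = x∈p∩q⁻ (J₁ ∩ J₂) _ j∈ ; j∈J₁ , j∈J₂ = x∈p∩q⁻ J₁ J₂ j∈J₁∩J₂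
               in j∈J₁ , j∈J₂ , λ { refl → x∈∁p⇒x∉p j∈∁ (x∈⁅x⁆ i) }

      Z⊆X : Z ⊆ X
      Z⊆X e∈ = let j , j∈J₃ , e∈Cⱼ = ∈-unionOver⁻ J₃ C e∈ ; j∈J₁ , _ , j≢i = ∈J₃ j∈J₃
               in ∈-unionOver⁺ j∈J₁ (∈-without-other _≟ₑ_ C i x j≢i e∈Cⱼ)

      Z⊆Y : Z ⊆ Y
      Z⊆Y e∈ = let j , j∈J₃ , e∈Cⱼ = ∈-unionOver⁻ J₃ C e∈ ; _ , j∈J₂ , j≢i = ∈J₃ j∈J₃
               in ∈-unionOver⁺ j∈J₂ (∈-without-other _≟ₑ_ C i y j≢i e∈Cⱼ)

      W⊆X++Y : W ⊆ X ++ Y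
      W⊆X++Y {e} e∈ with ∈-unionOver⁻ J₄ C e∈
      ... | j , j∈J₄ , e∈Cⱼ with j ≟ i
      ...   | no j≢i with x∈p∪q⁻ J₁ J₂ j∈J₄
      ...     | inj₁ j∈J₁ = ∈-++⁺ˡ (∈-unionOver⁺ j∈J₁ (∈-without-other _≟ₑ_ C i x j≢i e∈Cⱼ))
      ...     | inj₂ j∈J₂ = ∈-++⁺ʳ X (∈-unionOver⁺ j∈J₂ (∈-without-other _≟ₑ_ C i y j≢i e∈Cⱼ))
      W⊆X++Y {e} e∈ | j , j∈J₄ , e∈Cᵢ | yes refl with e ≟ₑ x
      ...     | no e≢x = ∈-++⁺ˡ (∈-unionOver⁺ i∈J₁ (∈-without-self _≟ₑ_ C i x e≢x e∈Cᵢ))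
      ...     | yes refl = ∈-++⁺ʳ X (∈-unionOver⁺ i∈J₂ (∈-without-self _≟ₑ_ C i y x≢y e∈Cᵢ))

      counts : count (_∈? J₁) + count (_∈? J₂) ≡ count (_∈? J₄) + suc (count (_∈? J₃))
      counts = trans (sym (count-∪-+-count-∩ J₁ J₂))
                     (cong (count (_∈? J₄) +_) (count-remove-∈ (J₁ ∩ J₂) (x∈p∩q⁺ (i∈J₁ , i∈J₂))))

    two-violations-impossible : ⊥
    two-violations-impossible = ℕ.<-irrefl refl (begin-strict
      suc (M⁺ + M⁺)             <⟨ ℕ.n<1+n _ ⟩
      suc (suc (M⁺ + M⁺))       ≡⟨ cong suc (ℕ.+-suc M⁺ M⁺) ⟨
      suc M⁺ + suc M⁺           ≤⟨ ℕ.+-mono-≤ violated₁ violated₂ ⟩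
      (a + j₁) + (b + j₂)       ≡⟨ interchange a j₁ b j₂ ⟩
      (a + b) + (j₁ + j₂)       ≤⟨ ℕ.+-mono-≤ submodular (ℕ.≤-reflexive counts) ⟩
      (z + w) + (j₄ + suc j₃)   ≡⟨ cong ((z + w) +_) (ℕ.+-comm j₄ (suc j₃)) ⟩
      (z + w) + (suc j₃ + j₄)   ≡⟨ interchange z (suc j₃) w j₄ ⟨
      (z + suc j₃) + (w + j₄)   ≡⟨ cong (_+ (w + j₄)) (ℕ.+-suc z j₃) ⟩
      suc ((z + j₃) + (w + j₄)) ≤⟨ ℕ.s≤s (ℕ.+-mono-≤ (rado J₃) (rado J₄)) ⟩
      suc (M⁺ + M⁺)             ∎)
      where
        open ℕ.≤-Reasoning
        M⁺ a b z w j₁ j₂ j₃ j₄ : ℕ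
        M⁺ = suc (m G)
        a = components X
        b = components Y
        z = components Z
        w = components W
        j₁ = count (_∈? J₁)
        j₂ = count (_∈? J₂)
        j₃ = count (_∈? J₃)
        j₄ = count (_∈? J₄)
        submodular : a + b ≤ z + w
        submodular = ℕ.≤-trans (components-submodular Z⊆X Z⊆Y) (ℕ.+-monoʳ-≤ z (components-antitone W⊆X++Y))

  rado-without : ∀ {C i x y} → Rado C → x ≢ y → Rado (without _≟ₑ_ C i x) ⊎ Rado (without _≟ₑ_ C i y)
  rado-without {C} {i} {x} {y} rado x≢y
    with rado⊎violated (without _≟ₑ_ C i x) | rado⊎violated (without _≟ₑ_ C i y)
  ... | inj₁ rado₁ | _ = inj₁ rado₁
  ... | inj₂ _ | inj₁ rado₂ = inj₂ rado₂
  ... | inj₂ (_ , violated₁) | inj₂ (_ , violated₂) =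
    ⊥-elim (two-violations-impossible rado x≢y violated₁ violated₂)

  rado-reduce : ∀ {C i} → Rado C → Distinct (C i) →
                ∃ λ C′ → Rado C′ × totalLength C′ < totalLength C × (∀ j → C′ j ⊆ C j)
  rado-reduce {C} {i} rado (x , y , x∈ , y∈ , x≢y) with rado-without rado x≢y
  ... | inj₁ rado′ = without _≟ₑ_ C i x , rado′ , totalLength-without _≟ₑ_ C x∈ , without-⊆ _≟ₑ_ C i x
  ... | inj₂ rado′ = without _≟ₑ_ C i y , rado′ , totalLength-without _≟ₑ_ C y∈ , without-⊆ _≟ₑ_ C i y

  shrink : ∀ C → Acc _<_ (totalLength C) → Rado C →
           ∃ λ C′ → Rado C′ × (∀ i → C′ i ⊆ C i) × (∀ i → Subsingleton (C′ i))
  shrink C (acc smaller) rado with ∀⊎∃ (subsingleton⊎distinct _≟ₑ_ ∘ C)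
  ... | inj₁ subsingletons = C , rado , (λ _ → id) , subsingletons
  ... | inj₂ (i , distinct) =
    let C′ , rado′ , shorter , C′⊆C = rado-reduce rado distinct
        C″ , rado″ , C″⊆C′ , subsingletons = shrink C′ (smaller shorter) rado′
    in C″ , rado″ , (λ j → C′⊆C j ∘ C″⊆C′ j) , subsingletons

  labelled : Candidates → List (Fin (m G) × Edge (n G))
  labelled C = unionOver ⊤ (λ i → map (i ,_) (C i))

  module _ {C : Candidates} where

    ∈-labelled⁺ : ∀ {i e} → e ∈ C i → (i , e) ∈ labelled C
    ∈-labelled⁺ {i} e∈ = ∈-unionOver⁺ {C = λ j → map (j ,_) (C j)} ∈⊤ (∈-map⁺ (i ,_) e∈)

    ∈-labelled⁻ : ∀ {i e} → (i , e) ∈ labelled C → e ∈ C i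
    ∈-labelled⁻ ie∈ with ∈-unionOver⁻ ⊤ (λ j → map (j ,_) (C j)) ie∈
    ... | j , _ , ie∈ⱼ with ∈-map⁻ (j ,_) ie∈ⱼ
    ...   | e , e∈ , refl = e∈

  spanningForest⇒trimming : ∀ {L} → (∀ {i e} → (i , e) ∈ L → Trims i e) → SpanningForest L →
                            (∀ u v → Walk (map proj₂ L) u v) → HasSpanningTreeTrimming G
  spanningForest⇒trimming trims F linked =
    length forest , proj₁ ∘ lookup forest , lookup-label-injective forest distinct ,
    ends , (λ p → trims (forest-⊆ (∈-lookup p))) ,
    linked⇒connected ends (λ u v → subst (λ E → Walk E u v) (sym tabulate-ends) (spans (linked u v))) ,
    components+size≡n⇒acyclic ends
      (trans (cong (λ E → components E + length forest) tabulate-ends) independent)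
    where
      open SpanningForest F
      ends : Fin (length forest) → Edge (n G)
      ends = proj₂ ∘ lookup forest
      tabulate-ends : tabulate ends ≡ map proj₂ forest
      tabulate-ends =
        trans (sym (map-tabulate (lookup forest) proj₂)) (cong (map proj₂) (tabulate-lookup forest))

  rado⇒spanningTreeTrimming : ∀ {C} → Rado C → (∀ i → C i ⊆ trimmings i) → (∀ i → Subsingleton (C i)) →
                              HasSpanningTreeTrimming G
  rado⇒spanningTreeTrimming {C} rado C⊆trimmings subsingletons =
    spanningForest⇒trimming (λ ie∈ → trimmings-sound (C⊆trimmings _ (∈-labelled⁻ ie∈)))
      (spanningForest (labelled C) λ ie∈ ie′∈ → subsingletons _ (∈-labelled⁻ ie∈) (∈-labelled⁻ ie′∈))
      (λ u v → walk-mono labelled-edge (components≤1⇒linked at-most-one u v))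
    where
      at-most-one : components (unionOver ⊤ C) ≤ 1
      at-most-one = ℕ.+-cancelʳ-≤ (m G) _ _
        (subst (λ c → components (unionOver ⊤ C) + c ≤ suc (m G)) (count-all (_∈? ⊤) (λ _ → ∈⊤)) (rado ⊤))
      labelled-edge : unionOver ⊤ C ⊆ map proj₂ (labelled C)
      labelled-edge e∈ = let i , _ , e∈Cᵢ = ∈-unionOver⁻ ⊤ C e∈ in ∈-map⁺ proj₂ (∈-labelled⁺ e∈Cᵢ)

  onePartitionConnected⇒spanningTreeTrimming : OnePartitionConnected G → HasSpanningTreeTrimming G
  onePartitionConnected⇒spanningTreeTrimming opc =
    let C , rado , C⊆trimmings , subsingletons =
          shrink trimmings (<-wellFounded _) (onePartitionConnected⇒rado opc)
    in rado⇒spanningTreeTrimming rado C⊆trimmings subsingletons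

theorem1p3 : (G : Hedgegraph) → WellFormed G →
             (OnePartitionConnected G ⇔ HasSpanningTreeTrimming G)
theorem1p3 G _ =
  mk⇔ (onePartitionConnected⇒spanningTreeTrimming G) (spanningTreeTrimming⇒onePartitionConnected G)
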